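{- Let $G$ be a cograph. If $G$ contains $P_3$ and $2K_2$ as induced subgraphs, then $G$ contains as an induced subgraph $Q_1 = P_3 \cup K_2$ or $Q_2 = $ the butterfly.
   Context: Graphs are finite and simple. A cograph is a graph with no induced $P_4$. $K_n$, $P_n$ denote the complete graph and the path on $n$ vertices; $G\cup H$ is the disjoint union and $kG$ is the disjoint union of $k$ copies of $G$. The butterfly is $K_1 \oplus 2K_2$, where $\oplus$ denotes the join (disjoint union plus all edges between the two parts); i.e. two triangles sharing exactly one vertex. -}

module Defs where

open import Data.Nat using (ℕ)
open import Data.Fin using (Fin; zero; suc)
open import Data.Bool using (Bool; true; false; T)
open import Data.Product using (Σ; _×_)
open import Relation.Binary.PropositionalEquality using (_≡_)
open import Relation.Nullary using (¬_)
open import Function.Definitions using (Injective)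
open import Function.Bundles using (_⇔_)
open import Data.Bool using (_≟_)
open import Data.Fin.Properties using (all?)
open import Relation.Nullary.Decidable using (True; toWitness)

record Graph : Set where
  field
    n      : ℕ
    adj    : Fin n → Fin n → Bool
    sym    : ∀ i j → adj i j ≡ adj j i
    irrefl : ∀ i → adj i i ≡ false
open Graph public

record InducedSub (H G : Graph) : Set where
  field
    f     : Fin (n H) → Fin (n G)
    inj   : Injective _≡_ _≡_ f
    edges : ∀ i j → adj G (f i) (f j) ≡ adj H i j
open InducedSub public

Contains : Graph → Graph → Set
Contains G H = InducedSub H G

P3adj : Fin 3 → Fin 3 → Bool
P3adj zero (suc zero) = true
P3adj (suc zero) zero = true
P3adj (suc zero) (suc (suc zero)) = true
P3adj (suc (suc zero)) (suc zero) = true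
P3adj _ _ = false

P4adj : Fin 4 → Fin 4 → Bool
P4adj zero (suc zero) = true
P4adj (suc zero) zero = true
P4adj (suc zero) (suc (suc zero)) = true
P4adj (suc (suc zero)) (suc zero) = true
P4adj (suc (suc zero)) (suc (suc (suc zero))) = true
P4adj (suc (suc (suc zero))) (suc (suc zero)) = true
P4adj _ _ = false

2K2adj : Fin 4 → Fin 4 → Bool
2K2adj zero (suc zero) = true
2K2adj (suc zero) zero = true
2K2adj (suc (suc zero)) (suc (suc (suc zero))) = true
2K2adj (suc (suc (suc zero))) (suc (suc zero)) = true
2K2adj _ _ = false

-- Q1 = P3 ∪ K2 : 0 - 1 - 2 ,  3 - 4
Q1adj : Fin 5 → Fin 5 → Bool
Q1adj zero (suc zero) = true
Q1adj (suc zero) zero = true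
Q1adj (suc zero) (suc (suc zero)) = true
Q1adj (suc (suc zero)) (suc zero) = true
Q1adj (suc (suc (suc zero))) (suc (suc (suc (suc zero)))) = true
Q1adj (suc (suc (suc (suc zero)))) (suc (suc (suc zero))) = true
Q1adj _ _ = false

-- Q2 = butterfly K1 ⊕ 2K2 : centre 0 adjacent to all; 1 - 2 ,  3 - 4
Q2adj : Fin 5 → Fin 5 → Bool
Q2adj zero zero = false
Q2adj zero (suc _) = true
Q2adj (suc _) zero = true
Q2adj (suc zero) (suc (suc zero)) = true
Q2adj (suc (suc zero)) (suc zero) = true
Q2adj (suc (suc (suc zero))) (suc (suc (suc (suc zero)))) = true
Q2adj (suc (suc (suc (suc zero)))) (suc (suc (suc zero))) = true
Q2adj _ _ = false


mkGraph : (k : ℕ) (a : Fin k → Fin k → Bool)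
  → {s : True (all? λ i → all? λ j → a i j ≟ a j i)}
  → {r : True (all? λ i → a i i ≟ false)}
  → Graph
mkGraph k a {s} {r} = record
  { n = k ; adj = a
  ; sym = λ i j → toWitness s i j
  ; irrefl = toWitness r }

P3 : Graph
P3 = mkGraph 3 P3adj

P4 : Graph
P4 = mkGraph 4 P4adj

2K2 : Graph
2K2 = mkGraph 4 2K2adj

Q1 : Graph
Q1 = mkGraph 5 Q1adj

Q2 : Graph
Q2 = mkGraph 5 Q2adj

Cograph : Graph → Set
Cograph G = ¬ Contains G P4

-- Fix an induced 2K₂ with edges xy and zw. In a cograph every other vertex either
-- already yields Q₁ or Q₂, or is joined to exactly {x, y}, to exactly {z, w}, or to none
-- of them: seeing exactly one end of an edge gives Q₁ or an induced P₄, and seeing all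
-- four ends gives the butterfly. Together with x, y the first kind forms a side closed
-- under taking neighbours, as do z, w with the second and the vertices of the third kind,
-- since edges between different sides create an induced P₄ or a Q₁. Hence an induced P₃
-- lies within one side. Two nonadjacent vertices of the side of xy form with x a P₃
-- anticomplete to zw, and a P₃ among vertices of the third kind is anticomplete to xy;
-- either way this is a Q₁.
module Submission where

open import Defs
open import Data.Bool using (Bool; true; false) renaming (_≟_ to _≟ᵇ_)
open import Data.Bool.Properties using (not-¬)
open import Data.Empty using (⊥-elim)
open import Data.Fin using (Fin; suc) renaming (_≟_ to _≟ᶠ_)
open import Data.Fin.Patterns using (0F; 1F; 2F; 3F; 4F)
open import Data.Fin.Properties using (all?)
open import Data.Product using (_×_; _,_)
open import Data.Sum using (_⊎_; inj₁; inj₂)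
open import Data.Unit using (tt)
open import Relation.Binary.PropositionalEquality
  using (_≡_; _≢_; refl; trans; cong) renaming (sym to ≡-sym)
open import Relation.Nullary using (Dec; yes; no; contradiction)
open import Relation.Nullary.Decidable using (True; toWitness; _×-dec_; _⊎-dec_; _→-dec_)

FalseTwins : (H : Graph) → Fin (n H) → Fin (n H) → Set
FalseTwins H i j = adj H i j ≡ false × (∀ l → adj H i l ≡ adj H j l)

falseTwins? : (H : Graph) → ∀ i j → Dec (FalseTwins H i j)
falseTwins? H i j = (adj H i j ≟ᵇ false) ×-dec all? (λ l → adj H i l ≟ᵇ adj H j l)

TwinFree : Graph → Set
TwinFree H = ∀ i j → FalseTwins H i j → i ≡ j

twinFree? : (H : Graph) → Dec (TwinFree H)
twinFree? H = all? λ i → all? λ j → falseTwins? H i j →-dec (i ≟ᶠ j)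

P4-twinFree : TwinFree P4
P4-twinFree = toWitness {a? = twinFree? P4} tt

Q2-twinFree : TwinFree Q2
Q2-twinFree = toWitness {a? = twinFree? Q2} tt

2K2-twinFree : TwinFree 2K2
2K2-twinFree = toWitness {a? = twinFree? 2K2} tt

Q1-falseTwins : ∀ i j → FalseTwins Q1 i j → i ≡ j ⊎ (i ≡ 0F × j ≡ 2F) ⊎ (i ≡ 2F × j ≡ 0F)
Q1-falseTwins = toWitness {a? = all? λ i → all? λ j → falseTwins? Q1 i j →-dec
  ((i ≟ᶠ j) ⊎-dec ((i ≟ᶠ 0F) ×-dec (j ≟ᶠ 2F)) ⊎-dec ((i ≟ᶠ 2F) ×-dec (j ≟ᶠ 0F)))} tt

Q2-suc-suc : ∀ i j → Q2adj (suc i) (suc j) ≡ 2K2adj i j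
Q2-suc-suc = toWitness {a? = all? λ i → all? λ j → Q2adj (suc i) (suc j) ≟ᵇ 2K2adj i j} tt

induced-trans : {H K G : Graph} → InducedSub H K → InducedSub K G → InducedSub H G
induced-trans h g = record
  { f     = λ i → f g (f h i)
  ; inj   = λ e → inj h (inj g e)
  ; edges = λ i j → trans (edges g (f h i) (f h j)) (edges h i j)
  }

module _ (G : Graph) where
  private
    V : Set
    V = Fin (n G)

    A : V → V → Bool
    A = adj G

  adj-sym : ∀ {u v b} → A u v ≡ b → A v u ≡ b
  adj-sym {u} {v} p = trans (sym G v u) p

  collision-falseTwins : {H : Graph} (fn : Fin (n H) → V) → (∀ i j → A (fn i) (fn j) ≡ adj H i j)
    → ∀ {i j} → fn i ≡ fn j → FalseTwins H i j
  collision-falseTwins fn ed {i} {j} e =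
      trans (≡-sym (ed i j)) (trans (cong (λ u → A u (fn j)) e) (irrefl G (fn j)))
    , λ l → trans (≡-sym (ed i l)) (trans (cong (λ u → A u (fn l)) e) (ed j l))

  induced : (H : Graph) (fn : Fin (n H) → V) → (∀ i j → A (fn i) (fn j) ≡ adj H i j)
    → (∀ i j → FalseTwins H i j → fn i ≡ fn j → i ≡ j) → InducedSub H G
  induced H fn ed separated = record
    { f = fn ; edges = ed ; inj = λ {i} {j} e → separated i j (collision-falseTwins {H} fn ed e) e }

  induced-twinFree : (H : Graph) → TwinFree H → (fn : Fin (n H) → V)
    → (∀ i j → A (fn i) (fn j) ≡ adj H i j) → InducedSub H G
  induced-twinFree H tf fn ed = induced H fn ed λ i j t _ → tf i j t

  induced-P4 : (a b c d : V)
    → A a b ≡ true → A a c ≡ false → A a d ≡ false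
    → A b c ≡ true → A b d ≡ false
    → A c d ≡ true
    → Contains G P4
  induced-P4 a b c d ab ac ad bc bd cd = induced-twinFree P4 P4-twinFree fn ed
    where
    fn : Fin 4 → V
    fn 0F = a ; fn 1F = b ; fn 2F = c ; fn 3F = d
    ed : ∀ i j → A (fn i) (fn j) ≡ P4adj i j
    ed 0F 0F = irrefl G a   ; ed 0F 1F = ab          ; ed 0F 2F = ac          ; ed 0F 3F = ad
    ed 1F 0F = adj-sym ab   ; ed 1F 1F = irrefl G b  ; ed 1F 2F = bc          ; ed 1F 3F = bd
    ed 2F 0F = adj-sym ac   ; ed 2F 1F = adj-sym bc  ; ed 2F 2F = irrefl G c  ; ed 2F 3F = cd
    ed 3F 0F = adj-sym ad   ; ed 3F 1F = adj-sym bd  ; ed 3F 2F = adj-sym cd  ; ed 3F 3F = irrefl G d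

  induced-Q1 : (a b c d e : V) → a ≢ c
    → A a b ≡ true → A a c ≡ false → A a d ≡ false → A a e ≡ false
    → A b c ≡ true → A b d ≡ false → A b e ≡ false
    → A c d ≡ false → A c e ≡ false
    → A d e ≡ true
    → Contains G Q1
  induced-Q1 a b c d e a≢c ab ac ad ae bc bd be cd ce de = induced Q1 fn ed separated
    where
    fn : Fin 5 → V
    fn 0F = a ; fn 1F = b ; fn 2F = c ; fn 3F = d ; fn 4F = e
    ed : ∀ i j → A (fn i) (fn j) ≡ Q1adj i j
    ed 0F 0F = irrefl G a  ; ed 0F 1F = ab         ; ed 0F 2F = ac         ; ed 0F 3F = ad         ; ed 0F 4F = ae
    ed 1F 0F = adj-sym ab  ; ed 1F 1F = irrefl G b ; ed 1F 2F = bc         ; ed 1F 3F = bd         ; ed 1F 4F = be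
    ed 2F 0F = adj-sym ac  ; ed 2F 1F = adj-sym bc ; ed 2F 2F = irrefl G c ; ed 2F 3F = cd         ; ed 2F 4F = ce
    ed 3F 0F = adj-sym ad  ; ed 3F 1F = adj-sym bd ; ed 3F 2F = adj-sym cd ; ed 3F 3F = irrefl G d ; ed 3F 4F = de
    ed 4F 0F = adj-sym ae  ; ed 4F 1F = adj-sym be ; ed 4F 2F = adj-sym ce ; ed 4F 3F = adj-sym de ; ed 4F 4F = irrefl G e
    separated : ∀ i j → FalseTwins Q1 i j → fn i ≡ fn j → i ≡ j
    separated i j t eq with Q1-falseTwins i j t
    ... | inj₁ i≡j                 = i≡j
    ... | inj₂ (inj₁ (refl , refl)) = ⊥-elim (a≢c eq)
    ... | inj₂ (inj₂ (refl , refl)) = ⊥-elim (a≢c (≡-sym eq))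

  cone-Q2 : (q : InducedSub 2K2 G) (v : V) → (∀ i → A v (f q i) ≡ true) → Contains G Q2
  cone-Q2 q v v∼q = induced-twinFree Q2 Q2-twinFree fn ed
    where
    fn : Fin 5 → V
    fn 0F      = v
    fn (suc i) = f q i
    ed : ∀ i j → A (fn i) (fn j) ≡ Q2adj i j
    ed 0F      0F      = irrefl G v
    ed 0F      (suc j) = v∼q j
    ed (suc i) 0F      = adj-sym (v∼q i)
    ed (suc i) (suc j) = trans (edges q i j) (≡-sym (Q2-suc-suc i j))

2K2-automorphism : (σ : Fin 4 → Fin 4)
  → {True (all? λ i → all? λ j → 2K2adj (σ i) (σ j) ≟ᵇ 2K2adj i j)}
  → InducedSub 2K2 2K2
2K2-automorphism σ {auto} = induced-twinFree 2K2 2K2 2K2-twinFree σ (toWitness auto)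

swap-ends : {G : Graph} → InducedSub 2K2 G → InducedSub 2K2 G
swap-ends = induced-trans (2K2-automorphism λ { 0F → 1F ; 1F → 0F ; 2F → 2F ; 3F → 3F })

swap-edges : {G : Graph} → InducedSub 2K2 G → InducedSub 2K2 G
swap-edges = induced-trans (2K2-automorphism λ { 0F → 2F ; 1F → 3F ; 2F → 0F ; 3F → 1F })

ContainsQ1orQ2 : Graph → Set
ContainsQ1orQ2 G = Contains G Q1 ⊎ Contains G Q2

module _ (G : Graph) where
  private
    V : Set
    V = Fin (n G)

    A : V → V → Bool
    A = adj G

  _∈N[_] : V → V → Set
  v ∈N[ u ] = v ≡ u ⊎ A v u ≡ true

  closedNbr-nonadjacent : ∀ {u a c} → a ∈N[ u ] → c ∈N[ u ] → a ≢ c → A a c ≡ false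
    → A a u ≡ true × A c u ≡ true
  closedNbr-nonadjacent (inj₁ refl) (inj₁ refl) a≢c _  = ⊥-elim (a≢c refl)
  closedNbr-nonadjacent (inj₁ refl) (inj₂ cu)   _   ac = ⊥-elim (not-¬ (adj-sym G cu) ac)
  closedNbr-nonadjacent (inj₂ au)   (inj₁ refl) _   ac = ⊥-elim (not-¬ au ac)
  closedNbr-nonadjacent (inj₂ au)   (inj₂ cu)   _   _  = au , cu

  -- The vertices 0F, 1F, 2F, 3F of q are x, y, z, w, so its edges are xy and zw.
  Side : InducedSub 2K2 G → V → Set
  Side q v = v ∈N[ f q 0F ] × v ∈N[ f q 1F ] × A v (f q 2F) ≡ false × A v (f q 3F) ≡ false

  Anticomplete : InducedSub 2K2 G → V → Set
  Anticomplete q v = ∀ i → A v (f q i) ≡ false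

  data Position (q : InducedSub 2K2 G) (v : V) : Set where
    found : ContainsQ1orQ2 G → Position q v
    side₁ : Side q v → Position q v
    side₂ : Side (swap-edges q) v → Position q v
    apart : Anticomplete q v → Position q v

  side-nonadjacent : (q : InducedSub 2K2 G) → ∀ {a c} → Side q a → Side q c → a ≢ c → A a c ≡ false
    → Contains G Q1
  side-nonadjacent q (a∼x , _ , az , aw) (c∼x , _ , cz , cw) a≢c ac
    with closedNbr-nonadjacent a∼x c∼x a≢c ac
  ... | ax , cx = induced-Q1 G _ _ _ _ _ a≢c ax ac az aw
                    (adj-sym G cx) (edges q 0F 2F) (edges q 0F 3F) cz cw (edges q 2F 3F)

  side-crossing : (q : InducedSub 2K2 G) → ∀ {b v} → Side q b → Side (swap-edges q) v → A b v ≡ true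
    → Contains G P4
  side-crossing q (_ , _ , bz , _) (inj₁ refl , _) bv = ⊥-elim (not-¬ bv bz)
  side-crossing q (inj₁ refl , _) (inj₂ _ , _ , vx , _) bv = ⊥-elim (not-¬ (adj-sym G bv) vx)
  side-crossing q (inj₂ bx , _ , bz , _) (inj₂ vz , _ , vx , _) bv =
    induced-P4 G _ _ _ _ (adj-sym G bx) (adj-sym G vx) (edges q 0F 2F) bv bz vz

  side-apart-edge : (q : InducedSub 2K2 G) → ∀ {b v} → Side q b → Anticomplete q v → A b v ≡ true
    → Contains G Q1
  side-apart-edge q (inj₁ refl , _) v-apart bv = ⊥-elim (not-¬ (adj-sym G bv) (v-apart 0F))
  side-apart-edge q {b} {v} (inj₂ bx , _ , bz , bw) v-apart bv =
    induced-Q1 G _ _ _ _ _ v≢x (adj-sym G bv) (v-apart 0F) (v-apart 2F) (v-apart 3F) bx bz bw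
      (edges q 0F 2F) (edges q 0F 3F) (edges q 2F 3F)
    where
    v≢x : v ≢ f q 0F
    v≢x refl = not-¬ (edges q 0F 1F) (v-apart 1F)

  module _ (cograph : Cograph G) where

    attached-to-one-end : (q : InducedSub 2K2 G) → ∀ {v} → v ≢ f q 1F
      → A v (f q 0F) ≡ true → A v (f q 1F) ≡ false → ContainsQ1orQ2 G
    attached-to-one-end q {v} v≢y vx vy with A v (f q 2F) in vz | A v (f q 3F) in vw
    ... | true  | _     = ⊥-elim (cograph (induced-P4 G _ _ _ _
      (edges q 1F 0F) (adj-sym G vy) (edges q 1F 2F) (adj-sym G vx) (edges q 0F 2F) vz))
    ... | false | true  = ⊥-elim (cograph (induced-P4 G _ _ _ _
      (edges q 1F 0F) (adj-sym G vy) (edges q 1F 3F) (adj-sym G vx) (edges q 0F 3F) vw))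
    ... | false | false = inj₁ (induced-Q1 G _ _ _ _ _ v≢y vx vy vz vw
      (edges q 0F 1F) (edges q 0F 2F) (edges q 0F 3F) (edges q 1F 2F) (edges q 1F 3F) (edges q 2F 3F))

    edge-attachment : (q : InducedSub 2K2 G) → ∀ {v} → v ≢ f q 0F → v ≢ f q 1F
      → ContainsQ1orQ2 G
        ⊎ (A v (f q 0F) ≡ true × A v (f q 1F) ≡ true)
        ⊎ (A v (f q 0F) ≡ false × A v (f q 1F) ≡ false)
    edge-attachment q {v} v≢x v≢y with A v (f q 0F) in vx | A v (f q 1F) in vy
    ... | true  | true  = inj₂ (inj₁ (refl , refl))
    ... | true  | false = inj₁ (attached-to-one-end q v≢y vx vy)
    ... | false | true  = inj₁ (attached-to-one-end (swap-ends q) v≢x vy vx)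
    ... | false | false = inj₂ (inj₂ (refl , refl))

    classify : (q : InducedSub 2K2 G) (v : V) → Position q v
    classify q v with v ≟ᶠ f q 0F | v ≟ᶠ f q 1F | v ≟ᶠ f q 2F | v ≟ᶠ f q 3F
    ... | yes refl | _ | _ | _ = side₁ (inj₁ refl , inj₂ (edges q 0F 1F) , edges q 0F 2F , edges q 0F 3F)
    ... | _ | yes refl | _ | _ = side₁ (inj₂ (edges q 1F 0F) , inj₁ refl , edges q 1F 2F , edges q 1F 3F)
    ... | _ | _ | yes refl | _ = side₂ (inj₁ refl , inj₂ (edges q 2F 3F) , edges q 2F 0F , edges q 2F 1F)
    ... | _ | _ | _ | yes refl = side₂ (inj₂ (edges q 3F 2F) , inj₁ refl , edges q 3F 0F , edges q 3F 1F)
    ... | no v≢x | no v≢y | no v≢z | no v≢w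
      with edge-attachment q v≢x v≢y | edge-attachment (swap-edges q) v≢z v≢w
    ...   | inj₁ r                 | _                      = found r
    ...   | inj₂ _                 | inj₁ r                 = found r
    ...   | inj₂ (inj₁ (vx , vy)) | inj₂ (inj₁ (vz , vw)) =
            found (inj₂ (cone-Q2 G q v λ { 0F → vx ; 1F → vy ; 2F → vz ; 3F → vw }))
    ...   | inj₂ (inj₁ (vx , vy)) | inj₂ (inj₂ (vz , vw)) = side₁ (inj₂ vx , inj₂ vy , vz , vw)
    ...   | inj₂ (inj₂ (vx , vy)) | inj₂ (inj₁ (vz , vw)) = side₂ (inj₂ vz , inj₂ vw , vx , vy)
    ...   | inj₂ (inj₂ (vx , vy)) | inj₂ (inj₂ (vz , vw)) =
            apart λ { 0F → vx ; 1F → vy ; 2F → vz ; 3F → vw }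

    side-closed : (q : InducedSub 2K2 G) → ∀ {b v} → Side q b → A b v ≡ true
      → ContainsQ1orQ2 G ⊎ Side q v
    side-closed q {v = v} sb bv with classify q v
    ... | found r = inj₁ r
    ... | side₁ s = inj₂ s
    ... | side₂ s = ⊥-elim (cograph (side-crossing q sb s bv))
    ... | apart a = inj₁ (inj₁ (side-apart-edge q sb a bv))

    apart-closed : (q : InducedSub 2K2 G) → ∀ {b v} → Anticomplete q b → A b v ≡ true
      → ContainsQ1orQ2 G ⊎ Anticomplete q v
    apart-closed q {v = v} b-apart bv with classify q v
    ... | found r = inj₁ r
    ... | side₁ s = inj₁ (inj₁ (side-apart-edge q s b-apart (adj-sym G bv)))
    ... | side₂ s = inj₁ (inj₁ (side-apart-edge (swap-edges q) s (λ i → b-apart _) (adj-sym G bv)))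
    ... | apart a = inj₂ a

    P3-centred-on-side : (q : InducedSub 2K2 G) → ∀ {a b c} → Side q b
      → A a b ≡ true → A b c ≡ true → A a c ≡ false → a ≢ c → ContainsQ1orQ2 G
    P3-centred-on-side q sb ab bc ac a≢c with side-closed q sb (adj-sym G ab) | side-closed q sb bc
    ... | inj₁ r  | _       = r
    ... | inj₂ _  | inj₁ r  = r
    ... | inj₂ sa | inj₂ sc = inj₁ (side-nonadjacent q sa sc a≢c ac)

    P3-centred-apart : (q : InducedSub 2K2 G) → ∀ {a b c} → Anticomplete q b
      → A a b ≡ true → A b c ≡ true → A a c ≡ false → a ≢ c → ContainsQ1orQ2 G
    P3-centred-apart q b-apart ab bc ac a≢c
      with apart-closed q b-apart (adj-sym G ab) | apart-closed q b-apart bc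
    ... | inj₁ r       | _            = r
    ... | inj₂ _       | inj₁ r       = r
    ... | inj₂ a-apart | inj₂ c-apart = inj₁ (induced-Q1 G _ _ _ _ _ a≢c ab ac (a-apart 0F) (a-apart 1F)
        bc (b-apart 0F) (b-apart 1F) (c-apart 0F) (c-apart 1F) (edges q 0F 1F))

    P3-with-2K2 : (q : InducedSub 2K2 G) → ∀ {a b c}
      → A a b ≡ true → A b c ≡ true → A a c ≡ false → a ≢ c → ContainsQ1orQ2 G
    P3-with-2K2 q {b = b} ab bc ac a≢c with classify q b
    ... | found r       = r
    ... | side₁ sb      = P3-centred-on-side q sb ab bc ac a≢c
    ... | side₂ sb      = P3-centred-on-side (swap-edges q) sb ab bc ac a≢c
    ... | apart b-apart = P3-centred-apart q b-apart ab bc ac a≢c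

lemma2 : (G : Graph) → Cograph G → Contains G P3 → Contains G 2K2
    → Contains G Q1 ⊎ Contains G Q2
lemma2 G cograph p q = P3-with-2K2 G cograph q (edges p 0F 1F) (edges p 1F 2F) (edges p 0F 2F)
  λ e → contradiction (inj p e) λ ()
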